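{- Let $G\le\mathrm{Sym}_n$ and write $\{1,\dots,n\}=B_1\,\dot\cup\,\cdots\,\dot\cup\, B_s$ as the disjoint union of the $G$-orbits. For each $i$ choose $x_i\in B_i$ and let $H_i=\mathrm{Stab}_G(x_i)$. For $1\le i\le s$ let $m_i=|\{j\in\{1,\dots,s\}\mid H_i \text{ is conjugate in } G \text{ to } H_j\}|$ and $n_i=[N_G(H_i):H_i]$. If $n_im_i$ is even for all $1\le i\le s$, then there is a $G$-invariant self-dual binary code $C\le\mathbb{F}_2^n$.
   Context: $\mathrm{Sym}_n$ acts on $\mathbb{F}_2^n$ by permuting coordinates; $C$ is $G$-invariant if $Cg=C$ for all $g\in G$, and self-dual if $C=C^\perp$ with respect to the standard scalar product $\sum x_iy_i$. -}

module Defs where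

open import Data.Nat using (ℕ)
open import Data.Bool using (Bool; true; false; _∧_; _xor_)
open import Data.Fin using (Fin; _≟_)
open import Data.Fin.Permutation using (Permutation′; _⟨$⟩ʳ_; _⟨$⟩ˡ_)
open import Data.List using (List; length; filter; allFin; foldr; map)
open import Data.List.Relation.Unary.Any using (Any; any?)
open import Data.List.Relation.Unary.All using (All; all?)
open import Data.List.Relation.Unary.AllPairs using (AllPairs)
open import Data.Product using (_×_)
open import Relation.Binary.PropositionalEquality using (_≡_)
open import Relation.Nullary using (¬_; Dec)
open import Relation.Nullary.Decidable using (_×-dec_; _→-dec_)

Perm : ℕ → Set
Perm n = Permutation′ n

_≈ₚ_ : ∀ {n} → Perm n → Perm n → Set
_≈ₚ_ {n} a b = ∀ (i : Fin n) → a ⟨$⟩ʳ i ≡ b ⟨$⟩ʳ i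

record PermGroup (n : ℕ) : Set where
  field
    elems     : List (Perm n)
    distinct  : AllPairs (λ a b → ¬ (a ≈ₚ b)) elems
    hasId     : Any (λ k → ∀ i → k ⟨$⟩ʳ i ≡ i) elems
    closed    : All (λ g → All (λ h → Any (λ k → ∀ i → k ⟨$⟩ʳ i ≡ g ⟨$⟩ʳ (h ⟨$⟩ʳ i)) elems) elems) elems
    invClosed : All (λ g → Any (λ k → ∀ i → k ⟨$⟩ʳ i ≡ g ⟨$⟩ˡ i) elems) elems
open PermGroup public

module _ {n : ℕ} (G : PermGroup n) where

  InStab : Fin n → Perm n → Set
  InStab x h = h ⟨$⟩ʳ x ≡ x

  inStab? : (x : Fin n) (h : Perm n) → Dec (InStab x h)
  inStab? x h = (h ⟨$⟩ʳ x) ≟ x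

  conjApp : Perm n → Perm n → Fin n → Fin n
  conjApp g h i = g ⟨$⟩ʳ (h ⟨$⟩ʳ (g ⟨$⟩ˡ i))

  -- g Stab_G(y) g⁻¹ = Stab_G(x)  (as subsets of G)
  ConjMaps : Fin n → Fin n → Perm n → Set
  ConjMaps x y g = All (λ h → (InStab y h → conjApp g h x ≡ x) × (conjApp g h x ≡ x → InStab y h)) (elems G)

  conjMaps? : (x y : Fin n) (g : Perm n) → Dec (ConjMaps x y g)
  conjMaps? x y g = all? (λ h → (inStab? y h →-dec (conjApp g h x ≟ x))
                              ×-dec ((conjApp g h x ≟ x) →-dec inStab? y h)) (elems G)

  Conjugate : Fin n → Fin n → Set
  Conjugate x y = Any (ConjMaps x y) (elems G)

  conjugate? : (x y : Fin n) → Dec (Conjugate x y)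
  conjugate? x y = any? (conjMaps? x y) (elems G)

  stabSize : Fin n → ℕ
  stabSize x = length (filter (inStab? x) (elems G))

  normSize : Fin n → ℕ
  normSize x = length (filter (conjMaps? x x) (elems G))

  conjCount : ∀ {s} → (Fin s → Fin n) → Fin s → ℕ
  conjCount {s} xs i = length (filter (λ j → conjugate? (xs i) (xs j)) (allFin s))

Word : ℕ → Set
Word n = Fin n → Bool

dot : ∀ {n} → Word n → Word n → Bool
dot {n} u v = foldr _xor_ false (map (λ i → u i ∧ v i) (allFin n))

_+w_ : ∀ {n} → Word n → Word n → Word n
(u +w v) i = u i xor v i

Code : ℕ → Set₁
Code n = Word n → Set

IsLinear : ∀ {n} → Code n → Set
IsLinear {n} C = C (λ _ → false) × (∀ u v → C u → C v → C (u +w v))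

SelfDual : ∀ {n} → Code n → Set
SelfDual {n} C = ∀ v → (C v → ∀ c → C c → dot c v ≡ false)
                     × ((∀ c → C c → dot c v ≡ false) → C v)

Invariant : ∀ {n} → PermGroup n → Code n → Set
Invariant {n} G C = All (λ g → ∀ v → (C v → C (λ i → v (g ⟨$⟩ˡ i)))
                                   × (C (λ i → v (g ⟨$⟩ˡ i)) → C v)) (elems G)

{-# OPTIONS --safe #-}
module Submission where

-- If σ is a fixed-point-free involution of {1,…,n} commuting with G, the words that are constant
-- on the pairs {p, σ p} form a G-invariant self-dual code.  Such a σ is determined by its values y_i on
-- the orbit representatives x_i, through σ (g x_i) = g y_i, which is well defined as soon as
-- Stab x_i ⊆ Stab y_i.  Orbits with conjugate stabilisers are paired off by a matching, and x_i is
-- sent to a point of its partner's orbit with the same stabiliser.  An orbit left unmatched is the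
-- only unmatched one in its conjugacy class, so m_i is odd and the hypothesis makes n_i even.
-- Then the inversion bH ↦ b⁻¹H of N_G(H)/H, which fixes H, fixes by parity another coset cH:
-- c ∈ N_G(H) ∖ H with c² ∈ H, and y_i = c x_i works.

open import Defs
open import Level using (0ℓ)
open import Algebra.Bundles using (CommutativeMonoid; CommutativeRing)
import Algebra.Properties.CommutativeMonoid.Sum as MonoidSum
open import Data.Bool using (Bool; true; false; not; _∧_; _xor_)
import Data.Bool as B
open import Data.Bool.Properties
  using (not-distribˡ-xor; xor-same; xor-comm; ∧-distribʳ-xor; xor-∧-commutativeRing)
open import Data.Nat using (ℕ; zero; suc; _+_; _*_; _≤_)
open import Data.Nat.Properties
  using (+-0-commutativeMonoid; +-*-semiring; +-identityʳ; *-comm; ≤-antisym; ≮⇒≥; even≢odd)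
open import Data.Nat.Divisibility using (_∣_; divides)
open import Data.Nat.Primality using (euclidsLemma; prime?)
open import Data.Fin using (Fin; zero; suc; _≟_; _<_; _<?_; punchIn)
open import Data.Fin.Properties
  using (punchInᵢ≢i; <⇒≢; ≤∧≢⇒<; <-asym; <-cmp; suc-injective; any?; injective⇒≤)
open import Data.Fin.Permutation
  using (Permutation′; permutation; _⟨$⟩ʳ_; _⟨$⟩ˡ_; inverseˡ; inverseʳ)
open import Data.List using (List; []; _∷_; length; filter; tabulate; foldr; lookup)
open import Data.List.Properties using (map-tabulate; filter-none)
open import Data.List.Relation.Unary.All using (All; []; _∷_; all?)
import Data.List.Relation.Unary.All as All
open import Data.List.Relation.Unary.Any using (Any)
import Data.List.Relation.Unary.Any as Any
open import Data.List.Relation.Unary.AllPairs using (AllPairs; _∷_)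
import Data.List.Relation.Unary.AllPairs.Properties as AllPairs
open import Data.List.Membership.Propositional using (_∈_; find; lose)
open import Data.List.Membership.Propositional.Properties using (∈-filter⁺; ∈-filter⁻; ∈-lookup)
open import Data.List.Membership.Setoid.Properties using (index-injective)
open import Data.Product using (Σ; _×_; _,_; proj₁; proj₂; ∃)
open import Data.Sum using ([_,_]′)
open import Function using (_∘_; id)
open import Relation.Nullary using (Dec; yes; no; does; ¬_; ¬?; contradiction)
open import Relation.Nullary.Decidable
  using (_×-dec_; _→-dec_; map′; dec-true; dec-false; decidable-stable; from-yes)
open import Relation.Unary using (Pred; Decidable)
open import Relation.Binary using (Rel; Reflexive; Symmetric; Tri; tri<; tri≈; tri>)
  renaming (Decidable to Decidable₂)
open import Relation.Binary.PropositionalEquality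
  using (_≡_; _≢_; refl; sym; trans; cong; cong₂; subst; module ≡-Reasoning)
  renaming (setoid to ≡-setoid)

-- Finite sums and counting

module _ {c ℓ} (M : CommutativeMonoid c ℓ) where
  open CommutativeMonoid M using (Carrier; _≈_; _∙_; ε; ∙-congˡ; identityʳ; setoid)
  open MonoidSum M using (sum; sum-remove; sum-cong-≋; sum-replicate-zero)
  open import Relation.Binary.Reasoning.Setoid setoid using (begin_; step-≈-⟩; _∎)

  sum-supported-at : ∀ {N} (t : Fin N → Carrier) (a : Fin N) →
                     (∀ j → j ≢ a → t j ≈ ε) → sum t ≈ t a
  sum-supported-at {suc N} t a vanishes = begin
    sum t                           ≈⟨ sum-remove {i = a} t ⟩
    t a ∙ sum (t ∘ punchIn a)       ≈⟨ ∙-congˡ (sum-cong-≋ {N} (λ j → vanishes _ (punchInᵢ≢i a j))) ⟩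
    t a ∙ sum {N} (λ _ → ε)         ≈⟨ ∙-congˡ (sum-replicate-zero N) ⟩
    t a ∙ ε                         ≈⟨ identityʳ (t a) ⟩
    t a                             ∎

open import Algebra.Properties.Semiring.Sum +-*-semiring
  using (sum; sum-cong-≗; sum-replicate-zero; ∑-distrib-+; sum-permute; *-distribʳ-sum)

indicator : ∀ {p} {A : Set p} → Dec A → ℕ
indicator (yes _) = 1
indicator (no _)  = 0

module _ {p q} {A : Set p} {B : Set q} where

  indicator-cong : (A → B) → (B → A) → (a? : Dec A) (b? : Dec B) → indicator a? ≡ indicator b?
  indicator-cong A⇒B B⇒A (yes _) (yes _) = refl
  indicator-cong A⇒B B⇒A (yes a) (no ¬b) = contradiction (A⇒B a) ¬b
  indicator-cong A⇒B B⇒A (no ¬a) (yes b) = contradiction (B⇒A b) ¬a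
  indicator-cong A⇒B B⇒A (no _)  (no _)  = refl

  indicator-split : (a? : Dec A) (b? : Dec B) →
                    indicator a? ≡ indicator (a? ×-dec b?) + indicator (a? ×-dec ¬? b?)
  indicator-split (yes _) (yes _) = refl
  indicator-split (yes _) (no _)  = refl
  indicator-split (no _)  (yes _) = refl
  indicator-split (no _)  (no _)  = refl

indicator-yes : ∀ {p} {A : Set p} (a? : Dec A) → A → indicator a? ≡ 1
indicator-yes (yes _) _ = refl
indicator-yes (no ¬a) a = contradiction a ¬a

indicator-no : ∀ {p} {A : Set p} (a? : Dec A) → ¬ A → indicator a? ≡ 0
indicator-no (yes a) ¬a = contradiction a ¬a
indicator-no (no _)  _  = refl

count : ∀ {N p} {P : Pred (Fin N) p} → Decidable P → ℕ
count P? = sum (λ i → indicator (P? i))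

module _ {N p q} {P : Pred (Fin N) p} {Q : Pred (Fin N) q} (P? : Decidable P) (Q? : Decidable Q) where

  count-cong : (∀ {i} → P i → Q i) → (∀ {i} → Q i → P i) → count P? ≡ count Q?
  count-cong P⇒Q Q⇒P = sum-cong-≗ (λ i → indicator-cong P⇒Q Q⇒P (P? i) (Q? i))

  count-split : count P? ≡ count (λ i → P? i ×-dec Q? i) + count (λ i → P? i ×-dec ¬? (Q? i))
  count-split = trans (sum-cong-≗ (λ i → indicator-split (P? i) (Q? i)))
    (∑-distrib-+ (λ i → indicator (P? i ×-dec Q? i)) (λ i → indicator (P? i ×-dec ¬? (Q? i))))

module _ {N p} {P : Pred (Fin N) p} (P? : Decidable P) where

  count-empty : (∀ i → ¬ P i) → count P? ≡ 0
  count-empty none = trans (sum-cong-≗ (λ i → indicator-no (P? i) (none i))) (sum-replicate-zero N)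

  count-unique : ∀ {a} → P a → (∀ {j} → P j → j ≡ a) → count P? ≡ 1
  count-unique {a} pa unique = trans
    (sum-supported-at +-0-commutativeMonoid _ a (λ j j≢a → indicator-no (P? j) (j≢a ∘ unique)))
    (indicator-yes (P? a) pa)

  count-permute : (π : Permutation′ N) → count P? ≡ count (P? ∘ (π ⟨$⟩ʳ_))
  count-permute π = sum-permute _ π

-- Involutions and parity

odd⇒¬even : ∀ {k a} → k ≡ 1 + 2 * a → ¬ 2 ∣ k
odd⇒¬even {k} {a} k≡odd (divides q k≡q*2) = even≢odd q a (trans (*-comm 2 q) (trans (sym k≡q*2) k≡odd))

module Involution {N} (π : Fin N → Fin N) (π-involutive : ∀ i → π (π i) ≡ i)
                  {p} {S : Pred (Fin N) p} (S? : Decidable S)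
                  (π-preserves-S : ∀ {i} → S i → S (π i)) where

  fixed? : Decidable (λ i → S i × π i ≡ i)
  fixed? i = S? i ×-dec (π i ≟ i)

  ascending? : Decidable (λ i → S i × i < π i)
  ascending? i = S? i ×-dec (i <? π i)

  descending? : Decidable (λ i → S i × π i < i)
  descending? i = S? i ×-dec (π i <? i)

  count-descending : count descending? ≡ count ascending?
  count-descending = trans (count-permute descending? (permutation π π π-involutive π-involutive))
    (count-cong (descending? ∘ π) ascending?
      (λ (s , lt) → subst S (π-involutive _) (π-preserves-S s) , subst (_< π _) (π-involutive _) lt)
      (λ (s , lt) → π-preserves-S s , subst (_< π _) (sym (π-involutive _)) lt))

  count-orbits : count S? ≡ count fixed? + 2 * count ascending?
  count-orbits = begin
    count S?
      ≡⟨ count-split S? (λ i → π i ≟ i) ⟩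
    count fixed? + count moved?
      ≡⟨ cong (count fixed? +_) (count-split moved? (λ i → i <? π i)) ⟩
    count fixed? + (count moved-up? + count moved-down?)
      ≡⟨ cong (λ m → count fixed? + m) (cong₂ _+_ moved-up moved-down) ⟩
    count fixed? + (count ascending? + count ascending?)
      ≡⟨ cong (λ m → count fixed? + (count ascending? + m)) (sym (+-identityʳ _)) ⟩
    count fixed? + 2 * count ascending?
      ∎
    where
    open ≡-Reasoning
    moved? : Decidable (λ i → S i × ¬ π i ≡ i)
    moved? i = S? i ×-dec ¬? (π i ≟ i)
    moved-up? : Decidable (λ i → (S i × ¬ π i ≡ i) × i < π i)
    moved-up? i = moved? i ×-dec (i <? π i)
    moved-down? : Decidable (λ i → (S i × ¬ π i ≡ i) × ¬ i < π i)
    moved-down? i = moved? i ×-dec ¬? (i <? π i)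
    moved-up : count moved-up? ≡ count ascending?
    moved-up = count-cong moved-up? ascending?
      (λ ((s , _) , lt) → s , lt) (λ (s , lt) → (s , (λ eq → <⇒≢ lt (sym eq))) , lt)
    moved-down : count moved-down? ≡ count ascending?
    moved-down = trans (count-cong moved-down? descending?
        (λ ((s , ne) , ¬lt) → s , ≤∧≢⇒< (≮⇒≥ ¬lt) ne)
        (λ (s , lt) → (s , <⇒≢ lt) , λ lt′ → <-asym lt lt′))
      count-descending

  fixed-point-free⇒even : (∀ {i} → S i → π i ≢ i) → count S? ≡ 2 * count ascending?
  fixed-point-free⇒even free = trans count-orbits
    (cong (_+ 2 * count ascending?) (count-empty fixed? (λ i (s , eq) → free s eq)))

  unique-fixed-point⇒odd : ∀ {a} → S a → π a ≡ a → (∀ {i} → S i → π i ≡ i → i ≡ a) →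
                           count S? ≡ 1 + 2 * count ascending?
  unique-fixed-point⇒odd sa πa unique = trans count-orbits
    (cong (_+ 2 * count ascending?) (count-unique fixed? (sa , πa) (λ (s , eq) → unique s eq)))

length-filter-∷ : ∀ {a p} {A : Set a} {P : Pred A p} (P? : Decidable P) x xs →
                  length (filter P? (x ∷ xs)) ≡ indicator (P? x) + length (filter P? xs)
length-filter-∷ P? x xs with P? x
... | yes _ = refl
... | no  _ = refl

module _ {a p} {A : Set a} {P : Pred A p} (P? : Decidable P) where

  length-filter-tabulate : ∀ {N} (f : Fin N → A) → length (filter P? (tabulate f)) ≡ count (P? ∘ f)
  length-filter-tabulate {zero}  f = refl
  length-filter-tabulate {suc N} f = trans (length-filter-∷ P? (f zero) _)
    (cong (indicator (P? (f zero)) +_) (length-filter-tabulate (f ∘ suc)))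

  length-filter-fibres : ∀ {N} (f : A → Fin N) xs →
    length (filter P? xs) ≡ sum (λ y → length (filter (λ x → P? x ×-dec (f x ≟ y)) xs))
  length-filter-fibres {N} f []       = sym (sum-replicate-zero N)
  length-filter-fibres {N} f (x ∷ xs) = begin
    length (filter P? (x ∷ xs))
      ≡⟨ length-filter-∷ P? x xs ⟩
    indicator (P? x) + length (filter P? xs)
      ≡⟨ cong₂ _+_ (fibre-of (P? x)) (length-filter-fibres f xs) ⟩
    sum {N} (λ y → indicator (P? x ×-dec (f x ≟ y))) + sum (λ y → fibre y xs)
      ≡⟨ sym (∑-distrib-+ (λ y → indicator (P? x ×-dec (f x ≟ y))) (λ y → fibre y xs)) ⟩
    sum (λ y → indicator (P? x ×-dec (f x ≟ y)) + fibre y xs)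
      ≡⟨ sum-cong-≗ (λ y → sym (length-filter-∷ (λ z → P? z ×-dec (f z ≟ y)) x xs)) ⟩
    sum (λ y → fibre y (x ∷ xs))
      ∎
    where
    open ≡-Reasoning
    fibre : Fin N → List A → ℕ
    fibre y = length ∘ filter (λ x → P? x ×-dec (f x ≟ y))
    fibre-of : (px? : Dec (P x)) → indicator px? ≡ count (λ y → px? ×-dec (f x ≟ y))
    fibre-of (yes px) = sym (count-unique (λ y → yes px ×-dec (f x ≟ y)) (px , refl) (λ (_ , eq) → sym eq))
    fibre-of (no ¬px) = sym (count-empty (λ y → no ¬px ×-dec (f x ≟ y)) (λ y → ¬px ∘ proj₁))

module _ {a p q} {A : Set a} {P : Pred A p} {Q : Pred A q} (P? : Decidable P) (Q? : Decidable Q) where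

  length-filter-cong : ∀ {xs} → All (λ x → (P x → Q x) × (Q x → P x)) xs →
                       length (filter P? xs) ≡ length (filter Q? xs)
  length-filter-cong {[]}     []                 = refl
  length-filter-cong {x ∷ xs} ((P⇒Q , Q⇒P) ∷ eqs) = begin
    length (filter P? (x ∷ xs))
      ≡⟨ length-filter-∷ P? x xs ⟩
    indicator (P? x) + length (filter P? xs)
      ≡⟨ cong₂ _+_ (indicator-cong P⇒Q Q⇒P (P? x) (Q? x)) (length-filter-cong eqs) ⟩
    indicator (Q? x) + length (filter Q? xs)
      ≡⟨ sym (length-filter-∷ Q? x xs) ⟩
    length (filter Q? (x ∷ xs))
      ∎
    where open ≡-Reasoning

-- Matchings

record Matching {s r} (R : Rel (Fin s) r) : Set r where
  field
    partner             : Fin s → Fin s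
    partner-involutive  : ∀ i → partner (partner i) ≡ i
    related-to-partner  : ∀ i → R i (partner i)
    unmatched-unrelated : ∀ {i j} → partner i ≡ i → partner j ≡ j → R i j → i ≡ j

-- Matches zero with t on top of a matching of the successors; t = zero leaves zero unmatched.
module ExtendMatching {s r} (R : Rel (Fin (suc s)) r) (R-sym : Symmetric R)
  (M : Matching (λ i j → R (suc i) (suc j))) (t : Fin (suc s)) (t-related : R zero t)
  (t-unmatched : ∀ {j} → t ≡ suc j → Matching.partner M j ≡ j)
  (zero-alone : t ≡ zero → ∀ {j} → Matching.partner M j ≡ j → ¬ R zero (suc j)) where

  open Matching M renaming ( partner to π ; partner-involutive to π-involutive
                          ; related-to-partner to related-to-π ; unmatched-unrelated to π-unmatched-unrelated )

  partner : Fin (suc s) → Fin (suc s)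
  partner zero    = t
  partner (suc i) with suc i ≟ t
  ... | yes _ = zero
  ... | no  _ = suc (π i)

  partner-at-t : ∀ {i} → suc i ≡ t → partner (suc i) ≡ zero
  partner-at-t {i} eq with suc i ≟ t
  ... | yes _ = refl
  ... | no ne = contradiction eq ne

  partner-off-t : ∀ {i} → suc i ≢ t → partner (suc i) ≡ suc (π i)
  partner-off-t {i} ne with suc i ≟ t
  ... | yes eq = contradiction eq ne
  ... | no _   = refl

  partner-involutive : ∀ i → partner (partner i) ≡ i
  partner-involutive zero = partner-of-t t refl
    where
    partner-of-t : ∀ u → u ≡ t → partner u ≡ zero
    partner-of-t zero    eq = sym eq
    partner-of-t (suc j) eq = partner-at-t eq
  partner-involutive (suc i) with suc i ≟ t
  ... | yes eq = sym eq
  ... | no ne  = trans (partner-off-t πi≢t) (cong suc (π-involutive i))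
    where
    πi≢t : suc (π i) ≢ t
    πi≢t eq = ne (trans (cong suc (trans (sym (π-involutive i)) (t-unmatched (sym eq)))) eq)

  related-to-partner : ∀ i → R i (partner i)
  related-to-partner zero = t-related
  related-to-partner (suc i) with suc i ≟ t
  ... | yes eq = R-sym (subst (R zero) (sym eq) t-related)
  ... | no _   = related-to-π i

  unmatched-off-t : ∀ {i} → partner (suc i) ≡ suc i → suc i ≢ t × π i ≡ i
  unmatched-off-t {i} fixed with suc i ≟ t
  ... | yes _ = contradiction fixed λ ()
  ... | no ne = ne , suc-injective fixed

  unmatched-unrelated : ∀ {i j} → partner i ≡ i → partner j ≡ j → R i j → i ≡ j
  unmatched-unrelated {zero}  {zero}  _  _  _ = refl
  unmatched-unrelated {zero}  {suc j} fi fj r = contradiction r (zero-alone fi (proj₂ (unmatched-off-t fj)))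
  unmatched-unrelated {suc i} {zero}  fi fj r = contradiction (R-sym r) (zero-alone fj (proj₂ (unmatched-off-t fi)))
  unmatched-unrelated {suc i} {suc j} fi fj r =
    cong suc (π-unmatched-unrelated (proj₂ (unmatched-off-t fi)) (proj₂ (unmatched-off-t fj)) r)

  matching : Matching R
  matching = record
    { partner = partner ; partner-involutive = partner-involutive
    ; related-to-partner = related-to-partner ; unmatched-unrelated = unmatched-unrelated
    }

matching : ∀ {s r} (R : Rel (Fin s) r) → Decidable₂ R → Reflexive R → Symmetric R → Matching R
matching {zero} R R? R-refl R-sym = record
  { partner = λ () ; partner-involutive = λ () ; related-to-partner = λ () ; unmatched-unrelated = λ { {()} } }
matching {suc s} R R? R-refl R-sym = extend (any? (λ j → (partner j ≟ j) ×-dec R? zero (suc j)))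
  where
  M : Matching (λ i j → R (suc i) (suc j))
  M = matching (λ i j → R (suc i) (suc j)) (λ i j → R? (suc i) (suc j)) R-refl R-sym
  open Matching M using (partner)
  extend : Dec (∃ λ j → partner j ≡ j × R zero (suc j)) → Matching R
  extend (yes (j , j-unmatched , r)) =
    ExtendMatching.matching R R-sym M (suc j) r (λ { refl → j-unmatched }) (λ ())
  extend (no none) =
    ExtendMatching.matching R R-sym M zero R-refl (λ ()) (λ _ {j} unmatched r → none (j , unmatched , r))

-- Codes constant on the pairs of an involution

open CommutativeRing xor-∧-commutativeRing using () renaming (+-commutativeMonoid to xor-commutativeMonoid)
open MonoidSum xor-commutativeMonoid using ()
  renaming (sum to xor-sum; sum-cong-≗ to xor-sum-cong; ∑-distrib-+ to xor-sum-distrib)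

parity : ℕ → Bool
parity zero    = false
parity (suc n) = not (parity n)

parity-+ : ∀ m n → parity (m + n) ≡ parity m xor parity n
parity-+ zero    n = refl
parity-+ (suc m) n = trans (cong not (parity-+ m n)) (not-distribˡ-xor (parity m) (parity n))

parity-double : ∀ q → parity (2 * q) ≡ false
parity-double q = trans (parity-+ q (q + 0))
  (trans (cong (λ k → parity q xor parity k) (+-identityʳ q)) (xor-same (parity q)))

xor-sum-parity : ∀ {N} (f : Fin N → Bool) → xor-sum f ≡ parity (count (λ i → f i B.≟ true))
xor-sum-parity {zero}  f = refl
xor-sum-parity {suc N} f = trans (cong (f zero xor_) (xor-sum-parity (f ∘ suc)))
  (sym (trans (parity-+ (indicator (f zero B.≟ true)) (count (λ i → f (suc i) B.≟ true)))
              (cong (_xor parity (count (λ i → f (suc i) B.≟ true))) (parity-indicator (f zero)))))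
  where
  parity-indicator : ∀ b → parity (indicator (b B.≟ true)) ≡ b
  parity-indicator false = refl
  parity-indicator true  = refl

dot-xor-sum : ∀ {n} (u v : Word n) → dot u v ≡ xor-sum (λ i → u i ∧ v i)
dot-xor-sum u v = trans (cong (foldr _xor_ false) (map-tabulate (λ i → i) (λ i → u i ∧ v i)))
  (foldr-tabulate (λ i → u i ∧ v i))
  where
  foldr-tabulate : ∀ {N} (f : Fin N → Bool) → foldr _xor_ false (tabulate f) ≡ xor-sum f
  foldr-tabulate {zero}  f = refl
  foldr-tabulate {suc N} f = cong (f zero xor_) (foldr-tabulate (f ∘ suc))

point : ∀ {n} → Fin n → Word n
point a j = does (j ≟ a)

dot-point : ∀ {n} (a : Fin n) (v : Word n) → dot (point a) v ≡ v a
dot-point a v = trans (dot-xor-sum (point a) v)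
  (trans (sum-supported-at xor-commutativeMonoid (λ j → point a j ∧ v j) a
           (λ j j≢a → cong (_∧ v j) (dec-false (j ≟ a) j≢a)))
         (cong (_∧ v a) (dec-true (a ≟ a) refl)))

dot-+w : ∀ {n} (u u′ v : Word n) → dot (u +w u′) v ≡ dot u v xor dot u′ v
dot-+w u u′ v = begin
  dot (u +w u′) v
    ≡⟨ dot-xor-sum (u +w u′) v ⟩
  xor-sum (λ i → (u i xor u′ i) ∧ v i)
    ≡⟨ xor-sum-cong (λ i → ∧-distribʳ-xor (v i) (u i) (u′ i)) ⟩
  xor-sum (λ i → (u i ∧ v i) xor (u′ i ∧ v i))
    ≡⟨ xor-sum-distrib (λ i → u i ∧ v i) (λ i → u′ i ∧ v i) ⟩
  xor-sum (λ i → u i ∧ v i) xor xor-sum (λ i → u′ i ∧ v i)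
    ≡⟨ sym (cong₂ _xor_ (dot-xor-sum u v) (dot-xor-sum u′ v)) ⟩
  dot u v xor dot u′ v
    ∎
  where open ≡-Reasoning

module PairCode {n} (σ : Fin n → Fin n) (σ-involutive : ∀ i → σ (σ i) ≡ i)
                (σ-fixed-point-free : ∀ i → σ i ≢ i) where

  pairCode : Code n
  pairCode v = ∀ i → v (σ i) ≡ v i

  pairCode-linear : IsLinear pairCode
  pairCode-linear = (λ _ → refl) , λ u v u∈C v∈C i → cong₂ _xor_ (u∈C i) (v∈C i)

  xor-sum-pairCode : ∀ w → pairCode w → xor-sum w ≡ false
  xor-sum-pairCode w w∈C = trans (xor-sum-parity w)
    (trans (cong parity (fixed-point-free⇒even (λ _ → σ-fixed-point-free _))) (parity-double (count ascending?)))
    where open Involution σ σ-involutive (λ i → w i B.≟ true) (λ {i} wi → trans (w∈C i) wi)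

  pair : Fin n → Word n
  pair i = point i +w point (σ i)

  point-σ : ∀ a j → point a (σ j) ≡ point (σ a) j
  point-σ a j with j ≟ σ a
  ... | yes refl = dec-true (σ (σ a) ≟ a) (σ-involutive a)
  ... | no  j≢σa = dec-false (σ j ≟ a) (λ σj≡a → j≢σa (trans (sym (σ-involutive j)) (cong σ σj≡a)))

  pair-∈ : ∀ i → pairCode (pair i)
  pair-∈ i j = begin
    point i (σ j) xor point (σ i) (σ j)   ≡⟨ cong₂ _xor_ (point-σ i j) (point-σ (σ i) j) ⟩
    point (σ i) j xor point (σ (σ i)) j   ≡⟨ cong (λ a → point (σ i) j xor point a j) (σ-involutive i) ⟩
    point (σ i) j xor point i j           ≡⟨ xor-comm (point (σ i) j) (point i j) ⟩
    point i j xor point (σ i) j           ∎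
    where open ≡-Reasoning

  pairCode-selfDual : SelfDual pairCode
  pairCode-selfDual v = orthogonal , complete
    where
    orthogonal : pairCode v → ∀ c → pairCode c → dot c v ≡ false
    orthogonal v∈C c c∈C = trans (dot-xor-sum c v) (xor-sum-pairCode _ (λ i → cong₂ _∧_ (c∈C i) (v∈C i)))
    xor≡false⇒≡ : ∀ x y → x xor y ≡ false → y ≡ x
    xor≡false⇒≡ false false _ = refl
    xor≡false⇒≡ true  true  _ = refl
    complete : (∀ c → pairCode c → dot c v ≡ false) → pairCode v
    complete orth i = xor≡false⇒≡ (v i) (v (σ i)) (begin
      v i xor v (σ i)                        ≡⟨ sym (cong₂ _xor_ (dot-point i v) (dot-point (σ i) v)) ⟩
      dot (point i) v xor dot (point (σ i)) v ≡⟨ sym (dot-+w (point i) (point (σ i)) v) ⟩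
      dot (pair i) v                         ≡⟨ orth (pair i) (pair-∈ i) ⟩
      false                                  ∎)
      where open ≡-Reasoning

  pairCode-permute : (g : Perm n) → (∀ p → σ (g ⟨$⟩ʳ p) ≡ g ⟨$⟩ʳ σ p) →
                     ∀ v → (pairCode v → pairCode (λ i → v (g ⟨$⟩ˡ i)))
                         × (pairCode (λ i → v (g ⟨$⟩ˡ i)) → pairCode v)
  pairCode-permute g commutes v = (λ v∈C i → trans (cong v (commutes⁻¹ i)) (v∈C (g ⟨$⟩ˡ i))) , back
    where
    open ≡-Reasoning
    commutes⁻¹ : ∀ p → g ⟨$⟩ˡ σ p ≡ σ (g ⟨$⟩ˡ p)
    commutes⁻¹ p = begin
      g ⟨$⟩ˡ σ p                           ≡⟨ cong (λ q → g ⟨$⟩ˡ σ q) (sym (inverseʳ g)) ⟩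
      g ⟨$⟩ˡ σ (g ⟨$⟩ʳ (g ⟨$⟩ˡ p))          ≡⟨ cong (g ⟨$⟩ˡ_) (commutes (g ⟨$⟩ˡ p)) ⟩
      g ⟨$⟩ˡ (g ⟨$⟩ʳ σ (g ⟨$⟩ˡ p))          ≡⟨ inverseˡ g ⟩
      σ (g ⟨$⟩ˡ p)                          ∎
    back : pairCode (λ i → v (g ⟨$⟩ˡ i)) → pairCode v
    back w∈C i = begin
      v (σ i)                      ≡⟨ cong v (sym (inverseˡ g)) ⟩
      v (g ⟨$⟩ˡ (g ⟨$⟩ʳ σ i))        ≡⟨ cong (λ q → v (g ⟨$⟩ˡ q)) (sym (commutes i)) ⟩
      v (g ⟨$⟩ˡ σ (g ⟨$⟩ʳ i))        ≡⟨ w∈C (g ⟨$⟩ʳ i) ⟩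
      v (g ⟨$⟩ˡ (g ⟨$⟩ʳ i))          ≡⟨ cong v (inverseˡ g) ⟩
      v i                           ∎

-- Permutation groups

module PermGroupTheory {n} (G : PermGroup n) where

  record Element : Set where
    constructor element
    field
      perm   : Perm n
      member : perm ∈ elems G
  open Element public

  infixl 7 _∙_
  infix  8 _⁻¹
  infixr 6 _·_

  _·_ : Element → Fin n → Fin n
  g · p = perm g ⟨$⟩ʳ p

  fromAny : ∀ {ℓ} {P : Perm n → Set ℓ} → Any P (elems G) → Σ Element (P ∘ perm)
  fromAny any with find any
  ... | k , k∈G , pk = element k k∈G , pk

  toAny : ∀ {ℓ} {P : Perm n → Set ℓ} (g : Element) → P (perm g) → Any P (elems G)
  toAny g = lose (member g)

  fromAll : ∀ {ℓ} {P : Perm n → Set ℓ} → All P (elems G) → ∀ g → P (perm g)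
  fromAll all g = All.lookup all (member g)

  toAll : ∀ {ℓ} {P : Perm n → Set ℓ} → (∀ g → P (perm g)) → All P (elems G)
  toAll f = All.tabulate (λ k∈G → f (element _ k∈G))

  _∙_ : Element → Element → Element
  g ∙ h = proj₁ (fromAny (All.lookup (All.lookup (closed G) (member g)) (member h)))

  ∙-· : ∀ g h p → (g ∙ h) · p ≡ g · h · p
  ∙-· g h = proj₂ (fromAny (All.lookup (All.lookup (closed G) (member g)) (member h)))

  _⁻¹ : Element → Element
  g ⁻¹ = proj₁ (fromAny (fromAll (invClosed G) g))

  ⁻¹-·-raw : ∀ g p → g ⁻¹ · p ≡ perm g ⟨$⟩ˡ p
  ⁻¹-·-raw g = proj₂ (fromAny (fromAll (invClosed G) g))

  ⁻¹-·-· : ∀ g p → g ⁻¹ · g · p ≡ p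
  ⁻¹-·-· g p = trans (⁻¹-·-raw g _) (inverseˡ (perm g))

  ·-⁻¹-· : ∀ g p → g · g ⁻¹ · p ≡ p
  ·-⁻¹-· g p = trans (cong (g ·_) (⁻¹-·-raw g p)) (inverseʳ (perm g))

  ·-injective : ∀ g {p q} → g · p ≡ g · q → p ≡ q
  ·-injective g {p} {q} eq = trans (sym (⁻¹-·-· g p)) (trans (cong (g ⁻¹ ·_) eq) (⁻¹-·-· g q))

  1ᴳ : Element
  1ᴳ = proj₁ (fromAny (hasId G))

  1ᴳ-· : ∀ p → 1ᴳ · p ≡ p
  1ᴳ-· = proj₂ (fromAny (hasId G))

  SameStab : Fin n → Fin n → Set
  SameStab p q = ∀ h → (h · p ≡ p → h · q ≡ q) × (h · q ≡ q → h · p ≡ p)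

  sameStab? : ∀ p q → Dec (SameStab p q)
  sameStab? p q = map′ fromAll toAll
    (all? (λ k → ((k ⟨$⟩ʳ p ≟ p) →-dec (k ⟨$⟩ʳ q ≟ q)) ×-dec ((k ⟨$⟩ʳ q ≟ q) →-dec (k ⟨$⟩ʳ p ≟ p)))
          (elems G))

  sameStab-refl : ∀ {p} → SameStab p p
  sameStab-refl h = (λ fixes → fixes) , (λ fixes → fixes)

  sameStab-sym : ∀ {p q} → SameStab p q → SameStab q p
  sameStab-sym same h = proj₂ (same h) , proj₁ (same h)

  sameStab-trans : ∀ {p q r} → SameStab p q → SameStab q r → SameStab p r
  sameStab-trans pq qr h = proj₁ (qr h) ∘ proj₁ (pq h) , proj₂ (pq h) ∘ proj₂ (qr h)

  ·-fixes⇒conjugate-fixes : ∀ g h p → h · g · p ≡ g · p → (g ⁻¹ ∙ h ∙ g) · p ≡ p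
  ·-fixes⇒conjugate-fixes g h p fixes = begin
    (g ⁻¹ ∙ h ∙ g) · p   ≡⟨ ∙-· (g ⁻¹ ∙ h) g p ⟩
    (g ⁻¹ ∙ h) · g · p   ≡⟨ ∙-· (g ⁻¹) h (g · p) ⟩
    g ⁻¹ · h · g · p     ≡⟨ cong (g ⁻¹ ·_) fixes ⟩
    g ⁻¹ · g · p         ≡⟨ ⁻¹-·-· g p ⟩
    p                    ∎
    where open ≡-Reasoning

  conjugate-fixes⇒·-fixes : ∀ g h p → (g ⁻¹ ∙ h ∙ g) · p ≡ p → h · g · p ≡ g · p
  conjugate-fixes⇒·-fixes g h p fixes = begin
    h · g · p                     ≡⟨ sym (·-⁻¹-· g _) ⟩
    g · g ⁻¹ · h · g · p          ≡⟨ cong (g ·_) (sym (trans (∙-· (g ⁻¹ ∙ h) g p) (∙-· (g ⁻¹) h (g · p)))) ⟩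
    g · (g ⁻¹ ∙ h ∙ g) · p        ≡⟨ cong (g ·_) fixes ⟩
    g · p                         ∎
    where open ≡-Reasoning

  sameStab-translate : ∀ g {p q} → SameStab p q → SameStab (g · p) (g · q)
  sameStab-translate g {p} {q} same h =
    conjugate-fixes⇒·-fixes g h q ∘ proj₁ (same (g ⁻¹ ∙ h ∙ g)) ∘ ·-fixes⇒conjugate-fixes g h p ,
    conjugate-fixes⇒·-fixes g h p ∘ proj₂ (same (g ⁻¹ ∙ h ∙ g)) ∘ ·-fixes⇒conjugate-fixes g h q

  sameStab-⁻¹ : ∀ g {p q} → SameStab p (g · q) → SameStab q (g ⁻¹ · p)
  sameStab-⁻¹ g {p} {q} same =
    sameStab-sym (subst (SameStab (g ⁻¹ · p)) (⁻¹-·-· g q) (sameStab-translate (g ⁻¹) same))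

  conjApp-· : ∀ g h p → conjApp G (perm g) (perm h) p ≡ (g ∙ h ∙ g ⁻¹) · p
  conjApp-· g h p = sym (begin
    (g ∙ h ∙ g ⁻¹) · p     ≡⟨ ∙-· (g ∙ h) (g ⁻¹) p ⟩
    (g ∙ h) · g ⁻¹ · p     ≡⟨ ∙-· g h (g ⁻¹ · p) ⟩
    g · h · g ⁻¹ · p       ≡⟨ cong (λ r → g · h · r) (⁻¹-·-raw g p) ⟩
    conjApp G (perm g) (perm h) p ∎)
    where open ≡-Reasoning

  unconjugate-· : ∀ g h p → (g ∙ (g ⁻¹ ∙ h ∙ g) ∙ g ⁻¹) · p ≡ h · p
  unconjugate-· g h p = begin
    (g ∙ (g ⁻¹ ∙ h ∙ g) ∙ g ⁻¹) · p     ≡⟨ trans (∙-· _ (g ⁻¹) p) (∙-· g _ (g ⁻¹ · p)) ⟩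
    g · (g ⁻¹ ∙ h ∙ g) · g ⁻¹ · p       ≡⟨ cong (g ·_) (trans (∙-· _ g _) (∙-· (g ⁻¹) h _)) ⟩
    g · g ⁻¹ · h · g · g ⁻¹ · p         ≡⟨ ·-⁻¹-· g _ ⟩
    h · g · g ⁻¹ · p                    ≡⟨ cong (h ·_) (·-⁻¹-· g p) ⟩
    h · p                               ∎
    where open ≡-Reasoning

  conjugate-·-· : ∀ g h q → (g ∙ h ∙ g ⁻¹) · g · q ≡ g · h · q
  conjugate-·-· g h q = begin
    (g ∙ h ∙ g ⁻¹) · g · q   ≡⟨ trans (∙-· (g ∙ h) (g ⁻¹) _) (∙-· g h _) ⟩
    g · h · g ⁻¹ · g · q     ≡⟨ cong (λ r → g · h · r) (⁻¹-·-· g q) ⟩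
    g · h · q                ∎
    where open ≡-Reasoning

  conjMaps⇒sameStab : ∀ {p q} g → ConjMaps G p q (perm g) → SameStab p (g · q)
  conjMaps⇒sameStab {p} {q} g maps h =
    (λ hp  → conjugate-fixes⇒·-fixes g h q (proj₂ (fromAll maps k) (trans conjApp-k hp))) ,
    (λ hgq → trans (sym conjApp-k) (proj₁ (fromAll maps k) (·-fixes⇒conjugate-fixes g h q hgq)))
    where
    k : Element
    k = g ⁻¹ ∙ h ∙ g
    conjApp-k : conjApp G (perm g) (perm k) p ≡ h · p
    conjApp-k = trans (conjApp-· g k p) (unconjugate-· g h p)

  sameStab⇒conjMaps : ∀ {p q} g → SameStab p (g · q) → ConjMaps G p q (perm g)
  sameStab⇒conjMaps {p} {q} g same = toAll λ h →
    (λ hq → trans (conjApp-· g h p)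
                  (proj₂ (same (g ∙ h ∙ g ⁻¹)) (trans (conjugate-·-· g h q) (cong (g ·_) hq)))) ,
    (λ fixes → ·-injective g (trans (sym (conjugate-·-· g h q))
                  (proj₁ (same (g ∙ h ∙ g ⁻¹)) (trans (sym (conjApp-· g h p)) fixes))))

  conjugate⇒sameStab : ∀ {p q} → Conjugate G p q → Σ Element λ g → SameStab p (g · q)
  conjugate⇒sameStab c with fromAny c
  ... | g , maps = g , conjMaps⇒sameStab g maps

  sameStab⇒conjugate : ∀ {p q} g → SameStab p (g · q) → Conjugate G p q
  sameStab⇒conjugate g same = toAny g (sameStab⇒conjMaps g same)

  conjugate-refl : ∀ {p} → Conjugate G p p
  conjugate-refl {p} = sameStab⇒conjugate 1ᴳ (subst (SameStab p) (sym (1ᴳ-· p)) sameStab-refl)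

  conjugate-sym : ∀ {p q} → Conjugate G p q → Conjugate G q p
  conjugate-sym c = sameStab⇒conjugate (g ⁻¹) (sameStab-⁻¹ g same)
    where open Σ (conjugate⇒sameStab c) renaming (proj₁ to g; proj₂ to same)

  conjugate-trans : ∀ {p q r} → Conjugate G p q → Conjugate G q r → Conjugate G p r
  conjugate-trans {p} {q} {r} c d = sameStab⇒conjugate (g ∙ h)
    (subst (SameStab p) (sym (∙-· g h r)) (sameStab-trans pq (sameStab-translate g qr)))
    where
    open Σ (conjugate⇒sameStab c) renaming (proj₁ to g; proj₂ to pq)
    open Σ (conjugate⇒sameStab d) renaming (proj₁ to h; proj₂ to qr)

  size : ∀ {ℓ} {P : Perm n → Set ℓ} → Decidable P → ℕ
  size P? = length (filter P? (elems G))

  distinct-lookup : ∀ {ks : List (Perm n)} → AllPairs (λ a b → ¬ a ≈ₚ b) ks →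
                    ∀ i j → lookup ks i ≈ₚ lookup ks j → i ≡ j
  distinct-lookup {_ ∷ _} (_  ∷ _)   zero    zero    _  = refl
  distinct-lookup {_ ∷ _} (k∉ ∷ _)   zero    (suc j) eq = contradiction eq (All.lookup k∉ (∈-lookup j))
  distinct-lookup {_ ∷ _} (k∉ ∷ _)   (suc i) zero    eq = contradiction (λ p → sym (eq p)) (All.lookup k∉ (∈-lookup i))
  distinct-lookup {_ ∷ _} (_  ∷ ks!) (suc i) (suc j) eq = cong suc (distinct-lookup ks! i j eq)

  size-≤ : ∀ {ℓ ℓ′} {P : Perm n → Set ℓ} {Q : Perm n → Set ℓ′} (P? : Decidable P) (Q? : Decidable Q)
           (φ : Element → Element) → (∀ g → P (perm g) → Q (perm (φ g))) →
           (∀ g h → perm (φ g) ≈ₚ perm (φ h) → perm g ≈ₚ perm h) → size P? ≤ size Q?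
  size-≤ {P = P} P? Q? φ preserves φ-injective = injective⇒≤ position-injective
    where
    ks = filter P? (elems G)
    at : Fin (length ks) → Element
    at i = element (lookup ks i) (proj₁ (∈-filter⁻ P? {xs = elems G} (∈-lookup i)))
    position : Fin (length ks) → Fin (size Q?)
    position i = Any.index (∈-filter⁺ Q? (member (φ (at i)))
                                          (preserves (at i) (proj₂ (∈-filter⁻ P? {xs = elems G} (∈-lookup i)))))
    position-injective : ∀ {i j} → position i ≡ position j → i ≡ j
    position-injective {i} {j} eq = distinct-lookup (AllPairs.filter⁺ P? (distinct G)) i j
      (φ-injective (at i) (at j) (λ p → cong (_⟨$⟩ʳ p) (index-injective (≡-setoid (Perm n)) _ _ eq)))

  coset-size : ∀ {x y} b → b · x ≡ y → size (λ k → k ⟨$⟩ʳ x ≟ y) ≡ stabSize G x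
  coset-size {x} {y} b bx≡y = ≤-antisym
    (size-≤ (λ k → k ⟨$⟩ʳ x ≟ y) (inStab? G x) (b ⁻¹ ∙_) into-stabilizer (cancel (b ⁻¹)))
    (size-≤ (inStab? G x) (λ k → k ⟨$⟩ʳ x ≟ y) (b ∙_) into-coset (cancel b))
    where
    into-stabilizer : ∀ g → g · x ≡ y → (b ⁻¹ ∙ g) · x ≡ x
    into-stabilizer g gx≡y = trans (∙-· (b ⁻¹) g x)
      (trans (cong (b ⁻¹ ·_) (trans gx≡y (sym bx≡y))) (⁻¹-·-· b x))
    into-coset : ∀ h → h · x ≡ x → (b ∙ h) · x ≡ y
    into-coset h hx≡x = trans (∙-· b h x) (trans (cong (b ·_) hx≡x) bx≡y)
    cancel : ∀ c g h → perm (c ∙ g) ≈ₚ perm (c ∙ h) → perm g ≈ₚ perm h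
    cancel c g h eq p = ·-injective c (trans (sym (∙-· c g p)) (trans (eq p) (∙-· c h p)))

  -- The N_G(Stab x)-orbit of x, of size n_x = [N_G(Stab x) : Stab x].
  InNormalizerOrbit : Fin n → Fin n → Set
  InNormalizerOrbit x y = (Σ Element λ b → b · x ≡ y) × SameStab x y

  inOrbit? : ∀ x y → Dec (Σ Element λ b → b · x ≡ y)
  inOrbit? x y = map′ fromAny (λ (b , bx≡y) → toAny b bx≡y) (Any.any? (λ k → k ⟨$⟩ʳ x ≟ y) (elems G))

  inNormalizerOrbit? : ∀ x → Decidable (InNormalizerOrbit x)
  inNormalizerOrbit? x y = inOrbit? x y ×-dec sameStab? x y

  normalizer-index : ∀ x → count (inNormalizerOrbit? x) * stabSize G x ≡ normSize G x
  normalizer-index x = begin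
    count (inNormalizerOrbit? x) * stabSize G x
      ≡⟨ *-distribʳ-sum (stabSize G x) (λ y → indicator (inNormalizerOrbit? x y)) ⟩
    sum (λ y → indicator (inNormalizerOrbit? x y) * stabSize G x)
      ≡⟨ sum-cong-≗ (λ y → sym (fibre-size y (inNormalizerOrbit? x y))) ⟩
    sum (λ y → size (fibre? y))
      ≡⟨ sym (length-filter-fibres (conjMaps? G x x) (_⟨$⟩ʳ x) (elems G)) ⟩
    normSize G x ∎
    where
    open ≡-Reasoning
    fibre? : ∀ y → Decidable (λ k → ConjMaps G x x k × k ⟨$⟩ʳ x ≡ y)
    fibre? y k = conjMaps? G x x k ×-dec (k ⟨$⟩ʳ x ≟ y)
    fibre-size : ∀ y (d : Dec (InNormalizerOrbit x y)) →
                 size (fibre? y) ≡ indicator d * stabSize G x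
    fibre-size y (yes ((b , bx≡y) , same)) = begin
      size (fibre? y)
        ≡⟨ length-filter-cong (fibre? y) (λ k → k ⟨$⟩ʳ x ≟ y) (toAll λ g →
             proj₂ , λ gx≡y → sameStab⇒conjMaps g (subst (SameStab x) (sym gx≡y) same) , gx≡y) ⟩
      size (λ k → k ⟨$⟩ʳ x ≟ y)  ≡⟨ coset-size b bx≡y ⟩
      stabSize G x               ≡⟨ sym (+-identityʳ (stabSize G x)) ⟩
      1 * stabSize G x           ∎
    fibre-size y (no ¬in) = cong length (filter-none (fibre? y) (toAll λ g (maps , gx≡y) →
      ¬in ((g , gx≡y) , subst (SameStab x) gx≡y (conjMaps⇒sameStab g maps))))

  record IsNormalizerInvolution (x : Fin n) (c : Element) : Set where
    field
      moves    : c · x ≢ x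
      squared  : c · c · x ≡ x
      sameStab : SameStab x (c · x)

  -- bH ↦ b⁻¹H on N_G(H)/H, for H = Stab x, transported to the points b x; the identity elsewhere.
  module Inversion (x : Fin n) where

    invert : ∀ {y} → Dec (InNormalizerOrbit x y) → Fin n
    invert     (yes ((b , _) , _)) = b ⁻¹ · x
    invert {y} (no _)              = y

    inversion : Fin n → Fin n
    inversion y = invert (inNormalizerOrbit? x y)

    record InversionWitness (y ψy : Fin n) : Set where
      field
        base     : Element
        base-x   : base · x ≡ y
        inverted : ψy ≡ base ⁻¹ · x

    invert-witness : ∀ {y} (d : Dec (InNormalizerOrbit x y)) → InNormalizerOrbit x y → InversionWitness y (invert d)
    invert-witness (yes ((b , bx≡y) , _)) _    = record { base = b ; base-x = bx≡y ; inverted = refl }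
    invert-witness (no ¬in)               in-y = contradiction in-y ¬in

    inversion-witness : ∀ {y} → InNormalizerOrbit x y → InversionWitness y (inversion y)
    inversion-witness = invert-witness (inNormalizerOrbit? x _)

    invert-outside : ∀ {y} (d : Dec (InNormalizerOrbit x y)) → ¬ InNormalizerOrbit x y → invert d ≡ y
    invert-outside (yes in-y) ¬in = contradiction in-y ¬in
    invert-outside (no _)     _   = refl

    inversion-outside : ∀ {y} → ¬ InNormalizerOrbit x y → inversion y ≡ y
    inversion-outside = invert-outside (inNormalizerOrbit? x _)

    inversion-preserves : ∀ {y} → InNormalizerOrbit x y → InNormalizerOrbit x (inversion y)
    inversion-preserves {y} in-y = (b ⁻¹ , sym inverted) ,
      subst (SameStab x) (sym inverted) (sameStab-⁻¹ b (subst (SameStab x) (sym base-x) (proj₂ in-y)))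
      where open InversionWitness (inversion-witness in-y) renaming (base to b)

    inversion-involutive : ∀ y → inversion (inversion y) ≡ y
    inversion-involutive y = involutive-on (inNormalizerOrbit? x y)
      where
      involutive-on : Dec (InNormalizerOrbit x y) → inversion (inversion y) ≡ y
      involutive-on (no ¬in)   = trans (cong inversion (inversion-outside ¬in)) (inversion-outside ¬in)
      involutive-on (yes in-y) = begin
        inversion (inversion y) ≡⟨ W′.inverted ⟩
        b′ ⁻¹ · x               ≡⟨ cong (b′ ⁻¹ ·_) (sym b′bx≡x) ⟩
        b′ ⁻¹ · b′ · b · x      ≡⟨ ⁻¹-·-· b′ (b · x) ⟩
        b · x                   ≡⟨ W.base-x ⟩
        y                       ∎
        where
        open ≡-Reasoning
        module W  = InversionWitness (inversion-witness in-y)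
        module W′ = InversionWitness (inversion-witness (inversion-preserves in-y))
        b b′ : Element
        b  = W.base
        b′ = W′.base
        b′b-fixes-ψy : (b′ ∙ b) · inversion y ≡ inversion y
        b′b-fixes-ψy = begin
          (b′ ∙ b) · inversion y   ≡⟨ ∙-· b′ b _ ⟩
          b′ · b · inversion y     ≡⟨ cong (λ p → b′ · b · p) W.inverted ⟩
          b′ · b · b ⁻¹ · x        ≡⟨ cong (b′ ·_) (·-⁻¹-· b x) ⟩
          b′ · x                   ≡⟨ W′.base-x ⟩
          inversion y              ∎
        b′bx≡x : b′ · b · x ≡ x
        b′bx≡x = trans (sym (∙-· b′ b x)) (proj₂ (proj₂ (inversion-preserves in-y) (b′ ∙ b)) b′b-fixes-ψy)

    x-inNormalizerOrbit : InNormalizerOrbit x x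
    x-inNormalizerOrbit = (1ᴳ , 1ᴳ-· x) , sameStab-refl

    inversion-x : inversion x ≡ x
    inversion-x = trans inverted (trans (cong (base ⁻¹ ·_) (sym base-x)) (⁻¹-·-· base x))
      where open InversionWitness (inversion-witness x-inNormalizerOrbit)

  -- The inversion fixes x; when the index is even, parity gives it a second fixed point b x.
  normalizerInvolution : ∀ x → 2 ∣ count (inNormalizerOrbit? x) → Σ Element (IsNormalizerInvolution x)
  normalizerInvolution x even =
    from-search (any? λ y → (inNormalizerOrbit? x y ×-dec (inversion y ≟ y)) ×-dec ¬? (y ≟ x))
    where
    open Inversion x
    from-search : Dec (∃ λ y → (InNormalizerOrbit x y × inversion y ≡ y) × y ≢ x) →
                  Σ Element (IsNormalizerInvolution x)
    from-search (yes (y , (in-y , fixed) , y≢x)) = base , record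
      { moves    = λ bx≡x → y≢x (trans (sym base-x) bx≡x)
      ; squared  = trans (cong (base ·_) (trans base-x (trans (sym fixed) inverted))) (·-⁻¹-· base x)
      ; sameStab = subst (SameStab x) (sym base-x) (proj₂ in-y)
      }
      where open InversionWitness (inversion-witness in-y)
    from-search (no none) = contradiction even
      (odd⇒¬even {a = count ascending?} (unique-fixed-point⇒odd x-inNormalizerOrbit inversion-x only-x))
      where
      open Involution inversion inversion-involutive (inNormalizerOrbit? x) inversion-preserves
      only-x : ∀ {y} → InNormalizerOrbit x y → inversion y ≡ y → y ≡ x
      only-x {y} in-y fixed = decidable-stable (y ≟ x) (λ y≢x → none (y , (in-y , fixed) , y≢x))

  module OrbitRepresentatives {s} (x : Fin s → Fin n)
    (cover : ∀ p → Σ (Fin s) λ i → Σ Element λ g → g · x i ≡ p)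
    (separate : ∀ {i j} g → g · x i ≡ x j → i ≡ j) where

    -- σ (g x i) = g y i; well defined because the orbits of the x i are disjoint.
    module Extension (y : Fin s → Fin n) (stab-⊆ : ∀ i h → h · x i ≡ x i → h · y i ≡ y i) where

      extend : Fin n → Fin n
      extend p = proj₁ (proj₂ (cover p)) · y (proj₁ (cover p))

      representative-step : ∀ {i j} k → k · x i ≡ x j → k · y i ≡ y j
      representative-step k kxᵢ≡xⱼ with separate k kxᵢ≡xⱼ
      ... | refl = stab-⊆ _ k kxᵢ≡xⱼ

      extend-well-defined : ∀ {i j} g h → g · x i ≡ h · x j → g · y i ≡ h · y j
      extend-well-defined {i} {j} g h gxᵢ≡hxⱼ = ·-injective (h ⁻¹) (begin
        h ⁻¹ · g · y i       ≡⟨ sym (∙-· (h ⁻¹) g (y i)) ⟩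
        (h ⁻¹ ∙ g) · y i     ≡⟨ representative-step (h ⁻¹ ∙ g) h⁻¹gxᵢ≡xⱼ ⟩
        y j                  ≡⟨ sym (⁻¹-·-· h (y j)) ⟩
        h ⁻¹ · h · y j       ∎)
        where
        open ≡-Reasoning
        h⁻¹gxᵢ≡xⱼ : (h ⁻¹ ∙ g) · x i ≡ x j
        h⁻¹gxᵢ≡xⱼ = trans (∙-· (h ⁻¹) g (x i)) (trans (cong (h ⁻¹ ·_) gxᵢ≡hxⱼ) (⁻¹-·-· h (x j)))

      extend-· : ∀ i g → extend (g · x i) ≡ g · y i
      extend-· i g = extend-well-defined (proj₁ (proj₂ (cover (g · x i)))) g (proj₂ (proj₂ (cover (g · x i))))

      extend-equivariant : ∀ g p → extend (g · p) ≡ g · extend p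
      extend-equivariant g p = begin
        extend (g · p)           ≡⟨ cong (λ q → extend (g · q)) (sym hxᵢ≡p) ⟩
        extend (g · h · x i)     ≡⟨ cong extend (sym (∙-· g h (x i))) ⟩
        extend ((g ∙ h) · x i)   ≡⟨ extend-· i (g ∙ h) ⟩
        (g ∙ h) · y i            ≡⟨ ∙-· g h (y i) ⟩
        g · h · y i              ∎
        where
        open ≡-Reasoning
        i = proj₁ (cover p)
        h = proj₁ (proj₂ (cover p))
        hxᵢ≡p = proj₂ (proj₂ (cover p))

      extend-involutive : (∀ i → Σ (Fin s) λ j → Σ Element λ g → g · x j ≡ y i × g · y j ≡ x i) →
                          ∀ p → extend (extend p) ≡ p
      extend-involutive paired p with paired (proj₁ (cover p))
      ... | j , g , gxⱼ≡yᵢ , gyⱼ≡xᵢ = begin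
        extend (h · y i)          ≡⟨ extend-equivariant h (y i) ⟩
        h · extend (y i)          ≡⟨ cong (λ q → h · extend q) (sym gxⱼ≡yᵢ) ⟩
        h · extend (g · x j)      ≡⟨ cong (h ·_) (trans (extend-· j g) gyⱼ≡xᵢ) ⟩
        h · x i                   ≡⟨ proj₂ (proj₂ (cover p)) ⟩
        p                         ∎
        where
        open ≡-Reasoning
        i = proj₁ (cover p)
        h = proj₁ (proj₂ (cover p))

      extend-fixed-point-free : (∀ i → y i ≢ x i) → ∀ p → extend p ≢ p
      extend-fixed-point-free moved p fixed =
        moved (proj₁ (cover p)) (·-injective (proj₁ (proj₂ (cover p))) (trans fixed (sym (proj₂ (proj₂ (cover p))))))

    ConjugateReps : Rel (Fin s) 0ℓ
    ConjugateReps i j = Conjugate G (x i) (x j)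

    conjugateReps? : Decidable₂ ConjugateReps
    conjugateReps? i j = conjugate? G (x i) (x j)

    module Matched (M : Matching ConjugateReps) where
      open Matching M renaming (partner to π; partner-involutive to π-involutive)

      unmatched⇒conjCount-odd : ∀ {i} → π i ≡ i → ∃ λ q → conjCount G x i ≡ 1 + 2 * q
      unmatched⇒conjCount-odd {i} unmatched = count ascending? , trans
        (length-filter-tabulate (conjugateReps? i) (λ j → j))
        (unique-fixed-point⇒odd conjugate-refl unmatched (λ c fixed → sym (unmatched-unrelated unmatched fixed c)))
        where open Involution π π-involutive (conjugateReps? i) (λ c → conjugate-trans c (related-to-partner _))

      module Partners (swapAt : ∀ i → π i ≡ i → Σ Element (IsNormalizerInvolution (x i))) where

        conjugator : Fin s → Fin s → Element
        conjugator i j with conjugateReps? i j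
        ... | yes c = proj₁ (conjugate⇒sameStab c)
        ... | no _  = 1ᴳ

        conjugator-sameStab : ∀ {i j} → ConjugateReps i j → SameStab (x i) (conjugator i j · x j)
        conjugator-sameStab {i} {j} c with conjugateReps? i j
        ... | yes c′ = proj₂ (conjugate⇒sameStab c′)
        ... | no ¬c  = contradiction c ¬c

        swap : Fin s → Element
        swap i with π i ≟ i
        ... | yes unmatched = proj₁ (swapAt i unmatched)
        ... | no _          = 1ᴳ

        swap-isNormalizerInvolution : ∀ {i} → π i ≡ i → IsNormalizerInvolution (x i) (swap i)
        swap-isNormalizerInvolution {i} unmatched with π i ≟ i
        ... | yes unmatched′ = proj₂ (swapAt i unmatched′)
        ... | no matched     = contradiction unmatched matched

        -- The partners of x i and x (π i) are chosen with the same conjugator, inverted on one side.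
        partnerPoint : Fin s → Fin n
        partnerPoint i with <-cmp i (π i)
        ... | tri< _ _ _ = conjugator i (π i) · x (π i)
        ... | tri≈ _ _ _ = swap i · x i
        ... | tri> _ _ _ = conjugator (π i) i ⁻¹ · x (π i)

        partnerPoint-below : ∀ {i} → i < π i → partnerPoint i ≡ conjugator i (π i) · x (π i)
        partnerPoint-below {i} lt with <-cmp i (π i)
        ... | tri< _ _ _    = refl
        ... | tri≈ ¬lt _ _  = contradiction lt ¬lt
        ... | tri> ¬lt _ _  = contradiction lt ¬lt

        partnerPoint-unmatched : ∀ {i} → π i ≡ i → partnerPoint i ≡ swap i · x i
        partnerPoint-unmatched {i} unmatched with <-cmp i (π i)
        ... | tri< _ ne _ = contradiction (sym unmatched) ne
        ... | tri≈ _ _ _  = refl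
        ... | tri> _ ne _ = contradiction (sym unmatched) ne

        partnerPoint-above : ∀ {i} → π i < i → partnerPoint i ≡ conjugator (π i) i ⁻¹ · x (π i)
        partnerPoint-above {i} gt with <-cmp i (π i)
        ... | tri< _ _ ¬gt = contradiction gt ¬gt
        ... | tri≈ _ _ ¬gt = contradiction gt ¬gt
        ... | tri> _ _ _   = refl

        partner-related : ∀ i → ConjugateReps (π i) i
        partner-related i = subst (ConjugateReps (π i)) (π-involutive i) (related-to-partner (π i))

        partnerPoint-sameStab : ∀ i → SameStab (x i) (partnerPoint i)
        partnerPoint-sameStab i with <-cmp i (π i)
        ... | tri< _ _ _         = conjugator-sameStab (related-to-partner i)
        ... | tri≈ _ i≡πi _      = IsNormalizerInvolution.sameStab (swap-isNormalizerInvolution (sym i≡πi))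
        ... | tri> _ _ _         = sameStab-⁻¹ (conjugator (π i) i) (conjugator-sameStab (partner-related i))

        partnerPoint-moves : ∀ i → partnerPoint i ≢ x i
        partnerPoint-moves i with <-cmp i (π i)
        ... | tri< _ i≢πi _ = λ gx≡x → i≢πi (sym (separate (conjugator i (π i)) gx≡x))
        ... | tri≈ _ i≡πi _ = IsNormalizerInvolution.moves (swap-isNormalizerInvolution (sym i≡πi))
        ... | tri> _ i≢πi _ = λ g⁻¹x≡x → i≢πi (separate g (trans (cong (g ·_) (sym g⁻¹x≡x)) (·-⁻¹-· g (x (π i)))))
          where g = conjugator (π i) i

        partnerPoint-paired : ∀ i → Σ Element λ g → g · x (π i) ≡ partnerPoint i × g · partnerPoint (π i) ≡ x i
        partnerPoint-paired i = paired-by (<-cmp i (π i))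
          where
          open ≡-Reasoning
          paired-by : Tri (i < π i) (i ≡ π i) (π i < i) →
                      Σ Element λ g → g · x (π i) ≡ partnerPoint i × g · partnerPoint (π i) ≡ x i
          paired-by (tri< lt _ _) = g , sym (partnerPoint-below lt) , (begin
            g · partnerPoint (π i)
              ≡⟨ cong (g ·_) (partnerPoint-above (subst (_< π i) (sym (π-involutive i)) lt)) ⟩
            g · conjugator (π (π i)) (π i) ⁻¹ · x (π (π i))
              ≡⟨ cong (λ t → g · conjugator t (π i) ⁻¹ · x t) (π-involutive i) ⟩
            g · g ⁻¹ · x i
              ≡⟨ ·-⁻¹-· g (x i) ⟩
            x i ∎)
            where
            g : Element
            g = conjugator i (π i)
          paired-by (tri≈ _ i≡πi _) = swap i ,
            trans (cong (λ t → swap i · x t) (sym i≡πi)) (sym (partnerPoint-unmatched (sym i≡πi))) , (begin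
            swap i · partnerPoint (π i)
              ≡⟨ cong (λ t → swap i · partnerPoint t) (sym i≡πi) ⟩
            swap i · partnerPoint i
              ≡⟨ cong (swap i ·_) (partnerPoint-unmatched (sym i≡πi)) ⟩
            swap i · swap i · x i
              ≡⟨ IsNormalizerInvolution.squared (swap-isNormalizerInvolution (sym i≡πi)) ⟩
            x i ∎)
          paired-by (tri> _ _ gt) = g ⁻¹ , sym (partnerPoint-above gt) , (begin
            g ⁻¹ · partnerPoint (π i)
              ≡⟨ cong (g ⁻¹ ·_) (partnerPoint-below (subst (π i <_) (sym (π-involutive i)) gt)) ⟩
            g ⁻¹ · conjugator (π i) (π (π i)) · x (π (π i))
              ≡⟨ cong (λ t → g ⁻¹ · conjugator (π i) t · x t) (π-involutive i) ⟩
            g ⁻¹ · g · x i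
              ≡⟨ ⁻¹-·-· g (x i) ⟩
            x i ∎)
            where
            g : Element
            g = conjugator (π i) i

        module PartnerExtension = Extension partnerPoint (λ i h → proj₁ (partnerPoint-sameStab i h))
        open PartnerExtension using () renaming (extend to σ; extend-equivariant to σ-equivariant) public

        σ-involutive : ∀ p → σ (σ p) ≡ p
        σ-involutive = PartnerExtension.extend-involutive (λ i → π i , partnerPoint-paired i)

        σ-fixed-point-free : ∀ p → σ p ≢ p
        σ-fixed-point-free = PartnerExtension.extend-fixed-point-free partnerPoint-moves

proposition2p8 : (n : ℕ) (G : PermGroup n) (s : ℕ) (x : Fin s → Fin n)
    → (∀ (p : Fin n) → ∃ λ (i : Fin s) → Any (λ g → g ⟨$⟩ʳ x i ≡ p) (elems G))
    → (∀ (i j : Fin s) → Any (λ g → g ⟨$⟩ʳ x i ≡ x j) (elems G) → i ≡ j)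
    → (∀ (i : Fin s) (k : ℕ) → k * stabSize G (x i) ≡ normSize G (x i)
         → 2 ∣ k * conjCount G x i)
    → ∃ λ (C : Code n) → IsLinear C × SelfDual C × Invariant G C
proposition2p8 n G s x covers separates index-parity =
  pairCode , pairCode-linear , pairCode-selfDual ,
  toAll (λ g → pairCode-permute (perm g) (σ-equivariant g))
  where
  open PermGroupTheory G
  open OrbitRepresentatives x (λ p → proj₁ (covers p) , fromAny (proj₂ (covers p)))
                              (λ g gxᵢ≡xⱼ → separates _ _ (toAny g gxᵢ≡xⱼ))

  M : Matching ConjugateReps
  M = matching ConjugateReps conjugateReps? conjugate-refl conjugate-sym
  open Matching M using (partner)
  open Matched M

  index-even : ∀ {i} → partner i ≡ i → 2 ∣ count (inNormalizerOrbit? (x i))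
  index-even {i} unmatched = [ id , (λ 2∣m → contradiction 2∣m (odd⇒¬even {a = q} m-odd)) ]′
    (euclidsLemma k _ (from-yes (prime? 2)) (index-parity i k (normalizer-index (x i))))
    where
    k : ℕ
    k = count (inNormalizerOrbit? (x i))
    open Σ (unmatched⇒conjCount-odd unmatched) renaming (proj₁ to q; proj₂ to m-odd)

  open Partners (λ i unmatched → normalizerInvolution (x i) (index-even unmatched))
  open PairCode σ σ-involutive σ-fixed-point-free
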